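{- Let $q$ be a prime power, $r\ge1$, and let $(G,R)$ be a $2$-coloring of $PG(r-1,q)$ such that $PG(r-1,q)|G$ is a target. Let $F$ be a nonempty flat of $PG(r-1,q)$. Then exactly one of $G\cap F$ and $R\cap F$ has rank $r(F)$.
   Context: $PG(r-1,q)$ denotes the rank-$r$ projective geometry over $GF(q)$; its flats are called projective flats. A $2$-coloring $(G,R)$ of $PG(r-1,q)$ is a partition of $E(PG(r-1,q))$ into possibly empty sets $G$ and $R$. For $X\subseteq E(PG(r-1,q))$, $PG(r-1,q)|X$ is a target if there is a sequence $(F_0,\dots,F_k)$ of possibly empty projective flats with $\emptyset=F_0\subseteq F_1\subseteq\dots\subseteq F_k=E(PG(r-1,q))$ such that $X$ is the union of the sets $F_{i+1}-F_i$ over all even $i$ with $0\le i\le k-1$. Ranks are computed in $PG(r-1,q)$. -}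

module Defs where

open import Level using (0ℓ)
open import Data.Nat as ℕ using (ℕ; zero; suc; _<_; _≤_)
open import Data.Nat.Primality using (Prime)
open import Data.Fin using (Fin)
import Data.Fin as Fin
open import Data.Vec using (Vec; replicate; map; zipWith)
open import Data.Product using (Σ; ∃; ∃-syntax; _×_; _,_)
open import Data.Sum using (_⊎_)
open import Data.Empty using (⊥)
open import Relation.Nullary using (¬_)
open import Relation.Binary.PropositionalEquality using (_≡_)
open import Algebra.Structures using (IsCommutativeRing)
open import Function.Bundles using (_↔_)

IsPrimePower : ℕ → Set
IsPrimePower q = ∃[ p ] ∃[ k ] (Prime p × q ≡ p ℕ.^ suc k)

-- A finite field with exactly q elements (this is GF(q), unique up to isomorphism).
record FiniteField (q : ℕ) : Set₁ where
  field
    Carrier : Set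
    _+_ _*_ : Carrier → Carrier → Carrier
    -_ : Carrier → Carrier
    0# 1# : Carrier
    isCommutativeRing : IsCommutativeRing _≡_ _+_ _*_ -_ 0# 1#
    0≢1 : ¬ (0# ≡ 1#)
    inverse : ∀ x → ¬ (x ≡ 0#) → ∃[ y ] (x * y ≡ 1#)
    enumeration : Carrier ↔ Fin q

module Geometry {q : ℕ} (K : FiniteField q) (r : ℕ) where
  open FiniteField K

  -- vectors of GF(q)^r; points of PG(r-1,q) are nonzero vectors up to nonzero scalars
  V : Set
  V = Vec Carrier r

  0v : V
  0v = replicate r 0#

  _⊕_ : V → V → V
  _⊕_ = zipWith _+_

  _•_ : Carrier → V → V
  c • v = map (c *_) v

  lincomb : ∀ {k} → (Fin k → Carrier) → (Fin k → V) → V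
  lincomb {zero} c u = 0v
  lincomb {suc k} c u = (c Fin.zero • u Fin.zero) ⊕ lincomb (λ i → c (Fin.suc i)) (λ i → u (Fin.suc i))

  Independent : ∀ {k} → (Fin k → V) → Set
  Independent u = ∀ c → lincomb c u ≡ 0v → ∀ i → c i ≡ 0#

  PSet : Set₁
  PSet = V → Set

  -- E(PG(r-1,q)): the nonzero vectors
  E : PSet
  E v = ¬ (v ≡ 0v)

  _∩_ : PSet → PSet → PSet
  (X ∩ Y) v = X v × Y v

  _⊆_ : PSet → PSet → Set
  X ⊆ Y = ∀ v → X v → Y v

  -- a set of points of PG(r-1,q): a set of nonzero vectors closed under nonzero scalars
  IsPointSet : PSet → Set
  IsPointSet X = (X ⊆ E) × (∀ c v → ¬ (c ≡ 0#) → X v → X (c • v))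

  IsFlat : PSet → Set
  IsFlat X = IsPointSet X ×
    (∀ k (u : Fin k → V) (c : Fin k → Carrier) → (∀ i → X (u i)) →
       E (lincomb c u) → X (lincomb c u))

  HasRank : PSet → ℕ → Set
  HasRank X k =
    (∃[ u ] (((i : Fin k) → X (u i)) × Independent {k} u)) ×
    (∀ (u : Fin (suc k) → V) → ((i : Fin (suc k)) → X (u i)) → ¬ Independent u)

  IsTwoColoring : PSet → PSet → Set
  IsTwoColoring G R =
    IsPointSet G × IsPointSet R ×
    (∀ v → E v → G v ⊎ R v) × (∀ v → G v → R v → ⊥)

  Even : ℕ → Set
  Even i = ∃[ j ] (i ≡ 2 ℕ.* j)

  IsTarget : PSet → Set₁
  IsTarget X = ∃[ k ] Σ (ℕ → PSet) λ F →
    ((∀ i → i ≤ k → IsFlat (F i)) ×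
     (∀ v → F 0 v → ⊥) ×
     (∀ i → i < k → F i ⊆ F (suc i)) ×
     (∀ v → (F k v → E v) × (E v → F k v)) ×
     (∀ v → (X v → ∃[ i ] (i < k × Even i × F (suc i) v × ¬ F i v)) ×
            (∃[ i ] (i < k × Even i × F (suc i) v × ¬ F i v) → X v)))

{-# OPTIONS --safe #-}
module Submission where

-- Let u be a basis of F and ∅ = F_0 ⊆ … ⊆ F_N the chain exhibiting G as a target. At the
-- first index i with u ⊆ F_{i+1} we have F ⊆ F_{i+1} but u_m ∉ F_i for some m, so every point
-- of F − F_i lies in the layer F_{i+1} − F_i and has one colour X (G iff i is even). The other
-- colour meets F only inside the flat F_i, which misses u_m, so it cannot contain k independent
-- vectors of F. Adding u_m to each u_l that lies in F_i gives a basis of F avoiding F_i, hence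
-- one inside X. Since membership in the flats is not decidable, this runs under double
-- negation; it is discharged because both rank statements are decidable by exhaustive search
-- over the finite field.

open import Level using (0ℓ)
open import Data.Nat using (ℕ; zero; suc; _<_; _≤_; _≤′_; ≤′-refl; ≤′-step; _≥_; z≤n)
import Data.Nat.Properties as ℕ
open import Data.Nat.Divisibility using (_∣?_; divides)
open import Data.Fin using (Fin; zero; suc)
import Data.Fin.Properties as FinP
open import Data.Vec using (Vec; []; _∷_; lookup; tabulate; replicate; map; zipWith)
import Data.Vec.Properties as VecP
import Data.Vec.Functional as Vector
open import Data.Product using (∃; ∃-syntax; _×_; _,_; proj₁; proj₂)
open import Data.Sum using (_⊎_; inj₁; inj₂; swap)
open import Data.Empty using (⊥; ⊥-elim)
open import Function using (_∘_)
open import Function.Bundles using (Inverse)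
open import Function.Properties.Inverse using (↔⇒↣)
open import Relation.Nullary using (¬_; Dec; yes; no)
open import Relation.Nullary.Decidable
  using (_×-dec_; ¬?; map′; via-injection; decidable-stable; ¬¬-excluded-middle)
open import Relation.Nullary.Negation using (¬¬-Monad; ¬¬-map)
open import Relation.Unary using (Pred; Decidable)
open import Relation.Binary using (DecidableEquality; tri<; tri≈; tri>)
open import Relation.Binary.PropositionalEquality
open import Algebra.Bundles using (CommutativeRing)
open import Effect.Monad using (RawMonad)

open import Defs

open RawMonad (¬¬-Monad {0ℓ}) using (_>>=_; _<$>_; rawApplicative)

¬¬-all : ∀ {k} {P : Fin k → Set} → (∀ i → ¬ ¬ P i) → ¬ ¬ (∀ i → P i)
¬¬-all = FinP.sequence rawApplicative

¬∀⇒¬¬∃¬ : ∀ {k} {P : Fin k → Set} → ¬ (∀ i → P i) → ¬ ¬ (∃[ i ] ¬ P i)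
¬∀⇒¬¬∃¬ ¬∀ ¬∃ = ¬¬-all (λ i ¬Pi → ¬∃ (i , ¬Pi)) ¬∀

¬¬-crossing : (P : ℕ → Set) → ¬ P 0 → ∀ N → P N → ¬ ¬ (∃[ i ] (i < N × ¬ P i × P (suc i)))
¬¬-crossing P ¬P0 zero P0 = λ _ → ¬P0 P0
¬¬-crossing P ¬P0 (suc n) PN = ¬¬-excluded-middle >>= λ
  { (yes Pn) → (λ { (i , i<n , c) → i , ℕ.m<n⇒m<1+n i<n , c }) <$> ¬¬-crossing P ¬P0 n Pn
  ; (no ¬Pn) → λ ¬c → ¬c (n , ℕ.n<1+n n , ¬Pn , PN) }

exactly-one : {A B : Set} → Dec A → Dec B → ¬ (A × B) → ¬ ¬ (A ⊎ B) → (A × ¬ B) ⊎ (B × ¬ A)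
exactly-one (yes a) _ ¬both _ = inj₁ (a , λ b → ¬both (a , b))
exactly-one (no ¬a) (yes b) _ _ = inj₂ (b , ¬a)
exactly-one (no ¬a) (no ¬b) _ either = ⊥-elim (either λ { (inj₁ a) → ¬a a ; (inj₂ b) → ¬b b })

dec-via-¬¬ : {A B : Set} → (B → A) → (A → ¬ ¬ B) → Dec B → Dec A
dec-via-¬¬ B⇒A A⇒¬¬B (yes b) = yes (B⇒A b)
dec-via-¬¬ B⇒A A⇒¬¬B (no ¬b) = no λ a → A⇒¬¬B a ¬b

Searchable : Set → Set₁
Searchable A = ∀ {P : Pred A 0ℓ} → Decidable P → Dec (∃ P)

searchable-Vec : ∀ {A} → Searchable A → ∀ n → Searchable (Vec A n)
searchable-Vec s zero P? = map′ ([] ,_) (λ { ([] , p) → p }) (P? [])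
searchable-Vec s (suc n) P? =
  map′ (λ { (x , xs , p) → x ∷ xs , p }) (λ { (x ∷ xs , p) → x , xs , p })
       (s (λ x → searchable-Vec s n (P? ∘ (x ∷_))))

search-≗ : ∀ {A n} → Searchable A → {P : Pred (Fin n → A) 0ℓ} →
           (∀ {f g} → f ≗ g → P f → P g) → Decidable P → Dec (∃ P)
search-≗ {n = n} s resp P? =
  map′ (λ { (v , p) → lookup v , p })
       (λ { (f , p) → tabulate f , resp (sym ∘ VecP.lookup∘tabulate f) p })
       (searchable-Vec s n (P? ∘ lookup))

module FieldFacts {q : ℕ} (K : FiniteField q) where
  open FiniteField K

  commutativeRing : CommutativeRing 0ℓ 0ℓ
  commutativeRing = record { isCommutativeRing = isCommutativeRing }

  infix 4 _≟_
  _≟_ : DecidableEquality Carrier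
  _≟_ = via-injection (↔⇒↣ enumeration) FinP._≟_

  searchable-Carrier : Searchable Carrier
  searchable-Carrier {P} P? =
    map′ (λ { (i , p) → from i , p })
         (λ { (x , p) → to x , subst P (sym (strictlyInverseʳ x)) p })
         (FinP.any? (P? ∘ from))
    where open Inverse enumeration

module LinearAlgebra {q : ℕ} (K : FiniteField q) (r : ℕ) where
  open FiniteField K public renaming (_+_ to infixl 6 _+_; _*_ to infixl 7 _*_)
  open FieldFacts K public
  open CommutativeRing commutativeRing
    using (+-assoc; +-comm; +-identityˡ; +-identityʳ; -‿inverseʳ; *-assoc; *-comm;
           *-identityˡ; distribˡ; distribʳ; zeroˡ; zeroʳ; ring; +-monoid)
  open import Algebra.Properties.Ring ring using (-1*x≈-x)
  open import Algebra.Properties.Monoid.Sum +-monoid using (sum; sum-cong-≗; sum-replicate-zero)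
  open Geometry K r public renaming (_⊕_ to infixl 6 _⊕_; _•_ to infixr 7 _•_)

  infix 4 _≟ᵥ_
  _≟ᵥ_ : DecidableEquality V
  _≟ᵥ_ = VecP.≡-dec _≟_

  ⊕-assoc : ∀ u v w → (u ⊕ v) ⊕ w ≡ u ⊕ (v ⊕ w)
  ⊕-assoc = VecP.zipWith-assoc +-assoc

  ⊕-comm : ∀ v w → v ⊕ w ≡ w ⊕ v
  ⊕-comm = VecP.zipWith-comm +-comm

  ⊕-identityˡ : ∀ v → 0v ⊕ v ≡ v
  ⊕-identityˡ = VecP.zipWith-identityˡ +-identityˡ

  ⊕-identityʳ : ∀ v → v ⊕ 0v ≡ v
  ⊕-identityʳ = VecP.zipWith-identityʳ +-identityʳ

  ⊕-interchange : ∀ a b c d → (a ⊕ b) ⊕ (c ⊕ d) ≡ (a ⊕ c) ⊕ (b ⊕ d)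
  ⊕-interchange a b c d = begin
    (a ⊕ b) ⊕ (c ⊕ d)  ≡⟨ ⊕-assoc a b (c ⊕ d) ⟩
    a ⊕ (b ⊕ (c ⊕ d))  ≡⟨ cong (a ⊕_) (sym (⊕-assoc b c d)) ⟩
    a ⊕ ((b ⊕ c) ⊕ d)  ≡⟨ cong (λ x → a ⊕ (x ⊕ d)) (⊕-comm b c) ⟩
    a ⊕ ((c ⊕ b) ⊕ d)  ≡⟨ cong (a ⊕_) (⊕-assoc c b d) ⟩
    a ⊕ (c ⊕ (b ⊕ d))  ≡⟨ sym (⊕-assoc a c (b ⊕ d)) ⟩
    (a ⊕ c) ⊕ (b ⊕ d)  ∎
    where open ≡-Reasoning

  •-identityˡ : ∀ v → 1# • v ≡ v
  •-identityˡ v = trans (VecP.map-cong *-identityˡ v) (VecP.map-id v)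

  •-assoc : ∀ a b v → (a * b) • v ≡ a • b • v
  •-assoc a b v = trans (VecP.map-cong (*-assoc a b) v) (VecP.map-∘ (a *_) (b *_) v)

  •-zeroˡ : ∀ v → 0# • v ≡ 0v
  •-zeroˡ v = trans (VecP.map-cong zeroˡ v) (VecP.map-const v 0#)

  •-zeroʳ : ∀ c → c • 0v ≡ 0v
  •-zeroʳ c = trans (VecP.map-replicate (c *_) 0# r) (cong (replicate r) (zeroʳ c))

  •-distribˡ : ∀ c v w → c • (v ⊕ w) ≡ c • v ⊕ c • w
  •-distribˡ c = go
    where
    go : ∀ {n} (v w : Vec Carrier n) →
         map (c *_) (zipWith _+_ v w) ≡ zipWith _+_ (map (c *_) v) (map (c *_) w)
    go [] [] = refl
    go (x ∷ v) (y ∷ w) = cong₂ _∷_ (distribˡ c x y) (go v w)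

  •-distribʳ : ∀ a b v → (a + b) • v ≡ a • v ⊕ b • v
  •-distribʳ a b = go
    where
    go : ∀ {n} (v : Vec Carrier n) →
         map ((a + b) *_) v ≡ zipWith _+_ (map (a *_) v) (map (b *_) v)
    go [] = refl
    go (x ∷ v) = cong₂ _∷_ (distribʳ x a b) (go v)

  ⊕-inverseʳ : ∀ v → v ⊕ (- 1#) • v ≡ 0v
  ⊕-inverseʳ v = trans (cong (v ⊕_) (VecP.map-cong -1*x≈-x v)) (VecP.zipWith-inverseʳ -‿inverseʳ v)

  ⊕≡0v⇒ : ∀ v w → v ⊕ w ≡ 0v → v ≡ (- 1#) • w
  ⊕≡0v⇒ v w v⊕w≡0 = begin
    v                        ≡⟨ sym (⊕-identityʳ v) ⟩
    v ⊕ 0v                   ≡⟨ cong (v ⊕_) (sym (⊕-inverseʳ w)) ⟩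
    v ⊕ (w ⊕ (- 1#) • w)     ≡⟨ sym (⊕-assoc v w _) ⟩
    (v ⊕ w) ⊕ (- 1#) • w     ≡⟨ cong (_⊕ (- 1#) • w) v⊕w≡0 ⟩
    0v ⊕ (- 1#) • w          ≡⟨ ⊕-identityˡ _ ⟩
    (- 1#) • w               ∎
    where open ≡-Reasoning

  lincomb-cong : ∀ {k} {c d : Fin k → Carrier} {u w : Fin k → V} →
                 c ≗ d → u ≗ w → lincomb c u ≡ lincomb d w
  lincomb-cong {zero} _ _ = refl
  lincomb-cong {suc k} c≗d u≗w =
    cong₂ _⊕_ (cong₂ _•_ (c≗d zero) (u≗w zero)) (lincomb-cong (c≗d ∘ suc) (u≗w ∘ suc))

  lincomb-zero : ∀ {k} (u : Fin k → V) → lincomb (λ _ → 0#) u ≡ 0v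
  lincomb-zero {zero} u = refl
  lincomb-zero {suc k} u = trans (cong₂ _⊕_ (•-zeroˡ (u zero)) (lincomb-zero (u ∘ suc))) (⊕-identityˡ 0v)

  lincomb-+ : ∀ {k} (a b : Fin k → Carrier) (u : Fin k → V) →
              lincomb (λ i → a i + b i) u ≡ lincomb a u ⊕ lincomb b u
  lincomb-+ {zero} a b u = sym (⊕-identityˡ 0v)
  lincomb-+ {suc k} a b u = trans
    (cong₂ _⊕_ (•-distribʳ (a zero) (b zero) (u zero)) (lincomb-+ (a ∘ suc) (b ∘ suc) (u ∘ suc)))
    (⊕-interchange _ _ _ _)

  lincomb-* : ∀ {k} t (a : Fin k → Carrier) (u : Fin k → V) →
              lincomb (λ i → t * a i) u ≡ t • lincomb a u
  lincomb-* {zero} t a u = sym (•-zeroʳ t)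
  lincomb-* {suc k} t a u = trans
    (cong₂ _⊕_ (•-assoc t (a zero) (u zero)) (lincomb-* t (a ∘ suc) (u ∘ suc)))
    (sym (•-distribˡ t _ _))

  lincomb-⊕ : ∀ {k} (c : Fin k → Carrier) (u w : Fin k → V) →
              lincomb c (λ i → u i ⊕ w i) ≡ lincomb c u ⊕ lincomb c w
  lincomb-⊕ {zero} c u w = sym (⊕-identityˡ 0v)
  lincomb-⊕ {suc k} c u w = trans
    (cong₂ _⊕_ (•-distribˡ (c zero) (u zero) (w zero)) (lincomb-⊕ (c ∘ suc) (u ∘ suc) (w ∘ suc)))
    (⊕-interchange _ _ _ _)

  lincomb-multiples : ∀ {k} (c a : Fin k → Carrier) (v : V) →
                      lincomb c (λ i → a i • v) ≡ sum (λ i → c i * a i) • v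
  lincomb-multiples {zero} c a v = sym (•-zeroˡ v)
  lincomb-multiples {suc k} c a v = trans
    (cong₂ _⊕_ (sym (•-assoc (c zero) (a zero) v)) (lincomb-multiples (c ∘ suc) (a ∘ suc) v))
    (sym (•-distribʳ _ _ v))

  unit : ∀ {k} → Fin k → Fin k → Carrier
  unit zero    zero    = 1#
  unit zero    (suc j) = 0#
  unit (suc l) zero    = 0#
  unit (suc l) (suc j) = unit l j

  unit-diag : ∀ {k} (l : Fin k) → unit l l ≡ 1#
  unit-diag zero    = refl
  unit-diag (suc l) = unit-diag l

  unit-offdiag : ∀ {k} (l j : Fin k) → l ≢ j → unit l j ≡ 0#
  unit-offdiag zero    zero    l≢j = ⊥-elim (l≢j refl)
  unit-offdiag zero    (suc j) _   = refl
  unit-offdiag (suc l) zero    _   = refl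
  unit-offdiag (suc l) (suc j) l≢j = unit-offdiag l j (l≢j ∘ cong suc)

  lincomb-unit : ∀ {k} (l : Fin k) (u : Fin k → V) → lincomb (unit l) u ≡ u l
  lincomb-unit zero u =
    trans (cong₂ _⊕_ (•-identityˡ (u zero)) (lincomb-zero (u ∘ suc))) (⊕-identityʳ (u zero))
  lincomb-unit (suc l) u =
    trans (cong₂ _⊕_ (•-zeroˡ (u zero)) (lincomb-unit l (u ∘ suc))) (⊕-identityˡ (u (suc l)))

  lincomb-⊕-unit : ∀ {k} (c : Fin k → Carrier) s m (u : Fin k → V) →
                   lincomb c u ⊕ s • u m ≡ lincomb (λ j → c j + s * unit m j) u
  lincomb-⊕-unit c s m u = sym (begin
    lincomb (λ j → c j + s * unit m j) u  ≡⟨ lincomb-+ c _ u ⟩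
    lincomb c u ⊕ lincomb (λ j → s * unit m j) u  ≡⟨ cong (lincomb c u ⊕_) (lincomb-* s (unit m) u) ⟩
    lincomb c u ⊕ s • lincomb (unit m) u  ≡⟨ cong (λ x → lincomb c u ⊕ s • x) (lincomb-unit m u) ⟩
    lincomb c u ⊕ s • u m  ∎)
    where open ≡-Reasoning

  independent-nonzero : ∀ {k} {u : Fin k → V} → Independent u → ∀ l → E (u l)
  independent-nonzero {u = u} ind l ul≡0 =
    0≢1 (trans (sym (ind (unit l) (trans (lincomb-unit l u) ul≡0) l)) (unit-diag l))

  independent-cong : ∀ {k} {u w : Fin k → V} → u ≗ w → Independent u → Independent w
  independent-cong u≗w ind c eq = ind c (trans (lincomb-cong (λ _ → refl) u≗w) eq)

  shear : ∀ {k} → Fin k → (Fin k → Carrier) → (Fin k → V) → Fin k → V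
  shear m t u l = u l ⊕ t l • u m

  shear-independent : ∀ {k} {u : Fin k → V} m t → t m ≡ 0# → Independent u → Independent (shear m t u)
  shear-independent {k} {u} m t tm≡0 ind c eq j = absorb j (trans (cong (_* unit m j) s≡0) (zeroˡ _))
    where
    s = sum (λ l → c l * t l)

    unsheared : lincomb (λ j → c j + s * unit m j) u ≡ 0v
    unsheared = begin
      lincomb (λ j → c j + s * unit m j) u  ≡⟨ sym (lincomb-⊕-unit c s m u) ⟩
      lincomb c u ⊕ s • u m                 ≡⟨ cong (lincomb c u ⊕_) (sym (lincomb-multiples c t (u m))) ⟩
      lincomb c u ⊕ lincomb c (λ l → t l • u m) ≡⟨ sym (lincomb-⊕ c u _) ⟩
      lincomb c (shear m t u)               ≡⟨ eq ⟩
      0v                                    ∎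
      where open ≡-Reasoning

    absorb : ∀ j → s * unit m j ≡ 0# → c j ≡ 0#
    absorb j e = trans (sym (trans (cong (c j +_) e) (+-identityʳ (c j)))) (ind _ unsheared j)

    off-m : ∀ j → j ≢ m → c j ≡ 0#
    off-m j j≢m = absorb j (trans (cong (s *_) (unit-offdiag m j (j≢m ∘ sym))) (zeroʳ s))

    s≡0 : s ≡ 0#
    s≡0 = trans (sum-cong-≗ term≡0) (sum-replicate-zero k)
      where
      term≡0 : ∀ l → c l * t l ≡ 0#
      term≡0 l with l FinP.≟ m
      ... | yes refl = trans (cong (c l *_) tm≡0) (zeroʳ (c l))
      ... | no  l≢m  = trans (cong (_* t l) (off-m l l≢m)) (zeroˡ (t l))

  Span : ∀ {k} → (Fin k → V) → PSet
  Span b p = ∃[ c ] p ≡ lincomb c b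

  independent-∷ : ∀ {k} {b : Fin k → V} {p} → Independent b → ¬ Span b p → Independent (p Vector.∷ b)
  independent-∷ {b = b} {p} ind p∉span d eq with d zero ≟ 0#
  ... | yes d₀≡0 = FinP.∀-cons d₀≡0 (ind (d ∘ suc) rest≡0)
    where
    rest≡0 : lincomb (d ∘ suc) b ≡ 0v
    rest≡0 = begin
      lincomb (d ∘ suc) b                   ≡⟨ sym (⊕-identityˡ _) ⟩
      0v ⊕ lincomb (d ∘ suc) b              ≡⟨ cong (_⊕ lincomb (d ∘ suc) b) (sym (•-zeroˡ p)) ⟩
      0# • p ⊕ lincomb (d ∘ suc) b          ≡⟨ cong (λ x → x • p ⊕ lincomb (d ∘ suc) b) (sym d₀≡0) ⟩
      d zero • p ⊕ lincomb (d ∘ suc) b      ≡⟨ eq ⟩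
      0v                                    ∎
      where open ≡-Reasoning
  ... | no d₀≢0 with inverse (d zero) d₀≢0
  ... | e , d₀e≡1 = ⊥-elim (p∉span (_ , p≡))
    where
    L = lincomb (d ∘ suc) b
    p≡ : p ≡ lincomb (λ i → e * - 1# * d (suc i)) b
    p≡ = begin
      p                      ≡⟨ sym (•-identityˡ p) ⟩
      1# • p                 ≡⟨ cong (_• p) (trans (sym d₀e≡1) (*-comm (d zero) e)) ⟩
      (e * d zero) • p       ≡⟨ •-assoc e (d zero) p ⟩
      e • d zero • p         ≡⟨ cong (e •_) (⊕≡0v⇒ _ L eq) ⟩
      e • (- 1#) • L         ≡⟨ sym (•-assoc e (- 1#) L) ⟩
      (e * - 1#) • L         ≡⟨ sym (lincomb-* (e * - 1#) (d ∘ suc) b) ⟩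
      lincomb (λ i → e * - 1# * d (suc i)) b ∎
      where open ≡-Reasoning

  span? : ∀ {k} (b : Fin k → V) → Decidable (Span b)
  span? b p = search-≗ searchable-Carrier (λ c≗d eq → trans eq (lincomb-cong c≗d (λ _ → refl)))
                                          (λ c → p ≟ᵥ lincomb c b)

  Dependence : ∀ {k} → (Fin k → V) → Pred (Fin k → Carrier) 0ℓ
  Dependence u c = lincomb c u ≡ 0v × ¬ (∀ i → c i ≡ 0#)

  independent? : ∀ {k} (u : Fin k → V) → Dec (Independent u)
  independent? u = map′ ¬dependence⇒independent (λ ind (c , eq , ¬zero) → ¬zero (ind c eq))
    (¬? (search-≗ searchable-Carrier respects
           (λ c → (lincomb c u ≟ᵥ 0v) ×-dec ¬? (FinP.all? (λ i → c i ≟ 0#)))))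
    where
    respects : ∀ {c d} → c ≗ d → Dependence u c → Dependence u d
    respects c≗d (eq , ¬zero) =
      trans (sym (lincomb-cong c≗d (λ _ → refl))) eq , λ zero → ¬zero (λ i → trans (c≗d i) (zero i))
    ¬dependence⇒independent : ¬ ∃ (Dependence u) → Independent u
    ¬dependence⇒independent ¬dep c eq =
      decidable-stable (FinP.all? (λ i → c i ≟ 0#)) (λ ¬zero → ¬dep (c , eq , ¬zero))

module Rank {q : ℕ} (K : FiniteField q) (r : ℕ) where
  open LinearAlgebra K r

  flat⇒⊆E : ∀ {X} → IsFlat X → X ⊆ E
  flat⇒⊆E = proj₁ ∘ proj₁

  flat-Span : ∀ {X k} {b : Fin k → V} → IsFlat X → (∀ l → X (b l)) → ∀ {p} → E p → Span b p → X p
  flat-Span {X} {k} {b} flat bX p≢0 (c , p≡) = subst X (sym p≡) (proj₂ flat k b c bX (subst E p≡ p≢0))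

  flat-⊕• : ∀ {X v w} c → IsFlat X → X v → X w → E (v ⊕ c • w) → X (v ⊕ c • w)
  flat-⊕• {v = v} {w} c flat Xv Xw ≢0 =
    flat-Span {b = v Vector.∷ w Vector.∷ Vector.[]} flat (FinP.∀-cons Xv (FinP.∀-cons Xw λ ())) ≢0
      (1# Vector.∷ c Vector.∷ Vector.[] , sym (cong₂ _⊕_ (•-identityˡ v) (⊕-identityʳ (c • w))))

  RankAtLeast : PSet → ℕ → Set
  RankAtLeast X k = ∃[ u ] ((∀ i → X (u i)) × Independent {k} u)

  RankAtMost : PSet → ℕ → Set
  RankAtMost X k = ∀ (u : Fin (suc k) → V) → (∀ i → X (u i)) → ¬ Independent u

  rankAtMost-⊆ : ∀ {X Y k} → X ⊆ Y → RankAtMost Y k → RankAtMost X k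
  rankAtMost-⊆ X⊆Y bound u uX = bound u (λ i → X⊆Y (u i) (uX i))

  maximal-independent-spans : ∀ {X k} {b : Fin k → V} → RankAtMost X k →
                              (∀ l → X (b l)) → Independent b → ∀ {p} → X p → ¬ ¬ Span b p
  maximal-independent-spans bound bX ind Xp p∉span =
    bound (_ Vector.∷ _) (FinP.∀-cons Xp bX) (independent-∷ ind p∉span)

  basis⊆flat⇒⊆¬¬ : ∀ {F F′ k} {b : Fin k → V} → IsFlat F → RankAtMost F k →
                   (∀ l → F (b l)) → Independent b → IsFlat F′ → (∀ l → F′ (b l)) →
                   ∀ v → F v → ¬ ¬ F′ v
  basis⊆flat⇒⊆¬¬ flat bound bF ind flat′ bF′ v Fv =
    ¬¬-map (flat-Span flat′ bF′ (flat⇒⊆E flat v Fv)) (maximal-independent-spans bound bF ind Fv)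

  SpannedBasis : ∀ {k} → PSet → (Fin k → V) → Pred (Vec V k) 0ℓ
  SpannedBasis X u w = (∀ l → X (lookup w l) × Span u (lookup w l)) × Independent (lookup w)

  spannedBasis? : ∀ {X k} → Decidable X → (u : Fin k → V) → Decidable (SpannedBasis X u)
  spannedBasis? X? u w =
    FinP.all? (λ l → X? (lookup w l) ×-dec span? u (lookup w l)) ×-dec independent? (lookup w)

  module _ {F : PSet} (flat : IsFlat F) {k} {u : Fin k → V}
           (uF : ∀ l → F (u l)) (uInd : Independent u) (bound : RankAtMost F k) where

    spannedBasis⇒hasRank : ∀ {X} → ∃ (SpannedBasis X u) → HasRank (X ∩ F) k
    spannedBasis⇒hasRank {X} (w , wX , wInd) =
      (lookup w , (λ l → proj₁ (wX l) , flat-Span flat uF (independent-nonzero wInd l) (proj₂ (wX l))) , wInd) ,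
      rankAtMost-⊆ {X ∩ F} (λ _ → proj₂) bound

    hasRank⇒¬¬spannedBasis : ∀ {X} → HasRank (X ∩ F) k → ¬ ¬ ∃ (SpannedBasis X u)
    hasRank⇒¬¬spannedBasis {X} ((w , wXF , wInd) , _) = spannedBasis <$> ¬¬-all w-spanned
      where
      w-spanned : ∀ l → ¬ ¬ Span u (w l)
      w-spanned l = maximal-independent-spans {F} bound uF uInd (proj₂ (wXF l))

      w≗ : w ≗ lookup (tabulate w)
      w≗ = sym ∘ VecP.lookup∘tabulate w

      spannedBasis : (∀ l → Span u (w l)) → ∃ (SpannedBasis X u)
      spannedBasis spans = tabulate w ,
        (λ l → subst X (w≗ l) (proj₁ (wXF l)) , subst (Span u) (w≗ l) (spans l)) , independent-cong w≗ wInd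

  hasRank-∩? : ∀ {X F k} → Decidable X → IsFlat F → HasRank F k → Dec (HasRank (X ∩ F) k)
  hasRank-∩? {X} {k = k} X? flat ((u , uF , uInd) , bound) =
    dec-via-¬¬ (spannedBasis⇒hasRank flat uF uInd bound {X}) (hasRank⇒¬¬spannedBasis flat uF uInd bound {X})
               (searchable-Vec (searchable-Vec searchable-Carrier r) k (spannedBasis? X? u))

  indicator : ∀ {A : Set} → Dec A → Carrier
  indicator (yes _) = 1#
  indicator (no _)  = 0#

  shear-avoids : ∀ {F′ k} {u : Fin k → V} {m} → IsFlat F′ → Independent u → ¬ F′ (u m) →
                 (F′? : ∀ l → Dec (F′ (u l))) → ∀ l → ¬ F′ (u l ⊕ indicator (F′? l) • u m)
  shear-avoids {F′} {u = u} {m} flat′ ind um∉ F′? l with F′? l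
  ... | no ul∉ = ul∉ ∘ subst F′ (trans (cong (u l ⊕_) (•-zeroˡ (u m))) (⊕-identityʳ (u l)))
  ... | yes ul∈ = λ wl∈ → um∉ (subst F′ (sheared-back (u l) (u m))
                    (flat-⊕• (- 1#) flat′ wl∈ ul∈
                      (subst E (sym (sheared-back (u l) (u m))) (independent-nonzero ind m))))
    where
    sheared-back : ∀ a b → (a ⊕ 1# • b) ⊕ (- 1#) • a ≡ b
    sheared-back a b = begin
      (a ⊕ 1# • b) ⊕ (- 1#) • a  ≡⟨ cong (λ x → (a ⊕ x) ⊕ (- 1#) • a) (•-identityˡ b) ⟩
      (a ⊕ b) ⊕ (- 1#) • a       ≡⟨ cong (_⊕ (- 1#) • a) (⊕-comm a b) ⟩
      (b ⊕ a) ⊕ (- 1#) • a       ≡⟨ ⊕-assoc b a _ ⟩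
      b ⊕ (a ⊕ (- 1#) • a)       ≡⟨ cong (b ⊕_) (⊕-inverseʳ a) ⟩
      b ⊕ 0v                     ≡⟨ ⊕-identityʳ b ⟩
      b                          ∎
      where open ≡-Reasoning

  module Dominance {F : PSet} (flat : IsFlat F) {k} {u : Fin k → V}
                   (uF : ∀ l → F (u l)) (uInd : Independent u) (bound : RankAtMost F k) where

    record Dominates (X F′ : PSet) : Set where
      field
        flat′   : IsFlat F′
        missed  : Fin k
        missed∉ : ¬ F′ (u missed)
        outside : ∀ v → F v → ¬ F′ v → ¬ ¬ X v

    module _ {X F′ : PSet} (dominates : Dominates X F′) where
      open Dominates dominates

      dominated-deficient : ∀ {Y} → (∀ v → X v → Y v → ⊥) → ¬ RankAtLeast (Y ∩ F) k
      dominated-deficient disjoint (b , bYF , bInd) =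
        ¬¬-all b∈F′ λ bF′ →
          basis⊆flat⇒⊆¬¬ flat bound (proj₂ ∘ bYF) bInd flat′ bF′ (u missed) (uF missed) missed∉
        where
        b∈F′ : ∀ l → ¬ ¬ F′ (b l)
        b∈F′ l b∉F′ = outside (b l) (proj₂ (bYF l)) b∉F′ (λ Xb → disjoint (b l) Xb (proj₁ (bYF l)))

      dominating-full-rank : ¬ ¬ HasRank (X ∩ F) k
      dominating-full-rank = ¬¬-all (λ _ → ¬¬-excluded-middle) >>= full-rank
        where
        full-rank : (∀ l → Dec (F′ (u l))) → ¬ ¬ HasRank (X ∩ F) k
        full-rank F′? =
          (λ wX → (w , (λ l → wX l , wF l) , wInd) , rankAtMost-⊆ {X ∩ F} (λ _ → proj₂) bound)
          <$> ¬¬-all (λ l → outside (w l) (wF l) (shear-avoids flat′ uInd missed∉ F′? l))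
          where
          w : Fin k → V
          w = shear missed (indicator ∘ F′?) u

          missed-unmoved : indicator (F′? missed) ≡ 0#
          missed-unmoved with F′? missed
          ... | yes m∈ = ⊥-elim (missed∉ m∈)
          ... | no _   = refl

          wInd : Independent w
          wInd = shear-independent missed _ missed-unmoved uInd

          wF : ∀ l → F (w l)
          wF l = flat-⊕• _ flat (uF l) (uF missed) (independent-nonzero wInd l)

module Target {q : ℕ} (K : FiniteField q) (r : ℕ) where
  open LinearAlgebra K r
  open Rank K r

  even? : Decidable Even
  even? n = map′ (λ { (divides j n≡j*2) → j , trans n≡j*2 (ℕ.*-comm j 2) })
                 (λ { (j , n≡2*j) → divides j (trans n≡2*j (ℕ.*-comm 2 j)) })
                 (2 ∣? n)

  colour? : ∀ {G R} → IsTwoColoring G R → Decidable G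
  colour? (G-points , _ , cover , disjoint) v with v ≟ᵥ 0v
  ... | yes v≡0 = no λ Gv → proj₁ G-points v Gv v≡0
  ... | no v≢0 with cover v v≢0
  ... | inj₁ Gv = yes Gv
  ... | inj₂ Rv = no λ Gv → disjoint v Gv Rv

  swap-colours : ∀ {G R} → IsTwoColoring G R → IsTwoColoring R G
  swap-colours (G-points , R-points , cover , disjoint) =
    R-points , G-points , (λ v v≢0 → swap (cover v v≢0)) , (λ v Rv Gv → disjoint v Gv Rv)

  module Chain {N : ℕ} {layer : ℕ → PSet} (chain : ∀ i → i < N → layer i ⊆ layer (suc i)) where

    chain-mono : ∀ {a b} → a ≤ b → b ≤ N → layer a ⊆ layer b
    chain-mono {a} a≤b = go (ℕ.≤⇒≤′ a≤b)
      where
      go : ∀ {b} → a ≤′ b → b ≤ N → layer a ⊆ layer b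
      go ≤′-refl _ _ h = h
      go (≤′-step a≤′b) sb≤N v = chain _ sb≤N v ∘ go a≤′b (ℕ.<⇒≤ sb≤N) v

    layer-unique : ∀ {i j v} → i < N → j < N →
                   layer (suc i) v → ¬ layer i v → layer (suc j) v → ¬ layer j v → i ≡ j
    layer-unique {i} {j} {v} i<N j<N vi ¬vi vj ¬vj with ℕ.<-cmp i j
    ... | tri< i<j _ _ = ⊥-elim (¬vj (chain-mono i<j (ℕ.<⇒≤ j<N) v vi))
    ... | tri≈ _ i≡j _ = i≡j
    ... | tri> _ _ j<i = ⊥-elim (¬vi (chain-mono j<i (ℕ.<⇒≤ i<N) v vj))

  module Colouring {G R : PSet} (colouring : IsTwoColoring G R)
                   {N : ℕ} {layer : ℕ → PSet} (flats : ∀ i → i ≤ N → IsFlat (layer i))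
                   (empty : ∀ v → layer 0 v → ⊥) (chain : ∀ i → i < N → layer i ⊆ layer (suc i))
                   (top : ∀ v → (layer N v → E v) × (E v → layer N v))
                   (G-layers : ∀ v → (G v → ∃[ i ] (i < N × Even i × layer (suc i) v × ¬ layer i v)) ×
                                     (∃[ i ] (i < N × Even i × layer (suc i) v × ¬ layer i v) → G v))
                   {F : PSet} (flat : IsFlat F) {v₀ : V} (Fv₀ : F v₀)
                   {k} {u : Fin k → V} (uF : ∀ l → F (u l)) (uInd : Independent u) (bound : RankAtMost F k) where
    open Chain chain
    open Dominance flat uF uInd bound

    G⊥R : ∀ v → G v → R v → ⊥
    G⊥R = proj₂ (proj₂ (proj₂ colouring))

    odd-layer⊆R : ∀ {i v} → i < N → ¬ Even i → layer (suc i) v → ¬ layer i v → R v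
    odd-layer⊆R {i} {v} i<N odd vi+1 ¬vi
      with proj₁ (proj₂ (proj₂ colouring)) v (flat⇒⊆E (flats (suc i) i<N) v vi+1)
    ... | inj₂ Rv = Rv
    ... | inj₁ Gv with proj₁ (G-layers v) Gv
    ... | j , j<N , even-j , vj+1 , ¬vj =
      ⊥-elim (odd (subst Even (layer-unique j<N i<N vj+1 ¬vj vi+1 ¬vi) even-j))

    ¬¬-dominated : ¬ ¬ (∃[ i ] (Dominates G (layer i) ⊎ Dominates R (layer i)))
    ¬¬-dominated = ¬¬-crossing Covers ¬covers-0 N covers-N >>= λ { (i , i<N , ¬covers-i , covers-i+1) →
      (λ { (m , um∉) → i , dominates i<N m um∉ covers-i+1 }) <$> ¬∀⇒¬¬∃¬ ¬covers-i }
      where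
      Covers : ℕ → Set
      Covers j = ∀ l → layer j (u l)

      ¬covers-0 : ¬ Covers 0
      ¬covers-0 covers = basis⊆flat⇒⊆¬¬ flat bound uF uInd (flats 0 z≤n) covers v₀ Fv₀ (empty v₀)

      covers-N : Covers N
      covers-N l = proj₂ (top (u l)) (flat⇒⊆E flat (u l) (uF l))

      dominates : ∀ {i} → i < N → ∀ m → ¬ layer i (u m) → Covers (suc i) →
                  Dominates G (layer i) ⊎ Dominates R (layer i)
      dominates {i} i<N m um∉ covers = by-parity (even? i)
        where
        dominated-by : ∀ {X} → (∀ {v} → layer (suc i) v → ¬ layer i v → X v) → Dominates X (layer i)
        dominated-by layer⊆X = record
          { flat′ = flats i (ℕ.<⇒≤ i<N) ; missed = m ; missed∉ = um∉
          ; outside = λ v Fv ¬vi → (λ vi+1 → layer⊆X vi+1 ¬vi)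
                                   <$> basis⊆flat⇒⊆¬¬ flat bound uF uInd (flats (suc i) i<N) covers v Fv }

        by-parity : Dec (Even i) → Dominates G (layer i) ⊎ Dominates R (layer i)
        by-parity (yes even-i) =
          inj₁ (dominated-by λ {v} vi+1 ¬vi → proj₂ (G-layers v) (i , i<N , even-i , vi+1 , ¬vi))
        by-parity (no odd) = inj₂ (dominated-by (odd-layer⊆R i<N odd))

    not-both : ¬ (HasRank (G ∩ F) k × HasRank (R ∩ F) k)
    not-both ((G-basis , _) , (R-basis , _)) = ¬¬-dominated λ
      { (_ , inj₁ G-dominates) → dominated-deficient G-dominates G⊥R R-basis
      ; (_ , inj₂ R-dominates) → dominated-deficient R-dominates (λ v Rv Gv → G⊥R v Gv Rv) G-basis }

    one-of : ¬ ¬ (HasRank (G ∩ F) k ⊎ HasRank (R ∩ F) k)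
    one-of = ¬¬-dominated >>= λ
      { (_ , inj₁ G-dominates) → inj₁ <$> dominating-full-rank G-dominates
      ; (_ , inj₂ R-dominates) → inj₂ <$> dominating-full-rank R-dominates }

lemma2p3 : (q : ℕ) → IsPrimePower q → (K : FiniteField q) → (r : ℕ) → r ≥ 1 →
    let open Geometry K r in
    (G R : PSet) → IsTwoColoring G R → IsTarget G →
    (F : PSet) → IsFlat F → (∃[ v ] F v) →
    (k : ℕ) → HasRank F k →
    (HasRank (G ∩ F) k × ¬ HasRank (R ∩ F) k) ⊎ (HasRank (R ∩ F) k × ¬ HasRank (G ∩ F) k)
lemma2p3 q _ K r _ G R colouring (N , layer , flats , empty , chain , top , G-layers)
         F flat (v₀ , Fv₀) k rank@((u , uF , uInd) , bound) =
  exactly-one (hasRank-∩? (colour? colouring) flat rank)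
              (hasRank-∩? (colour? (swap-colours colouring)) flat rank)
              not-both one-of
  where
  open Rank K r
  open Target K r
  open Colouring colouring flats empty chain top G-layers flat Fv₀ uF uInd bound
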